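{- $U_{4,7}$ is an excluded minor for the class of quasi-graphic matroids, i.e., $U_{4,7}$ is not quasi-graphic but every proper minor of $U_{4,7}$ is quasi-graphic.
   Context: Graphs may have loops and parallel edges. For a graph $H$ and vertex $v$, $\mathrm{loops}_H(v)$ denotes the set of loops of $H$ at $v$. A graph $H$ is a framework for a matroid $N$ if (QG1) $E(H)=E(N)$; (QG2) $r_N(E(H'))\le |V(H')|$ for each component $H'$ of $H$; (QG3) for each vertex $v$ of $H$, $\mathrm{cl}_N(E(H-v))\subseteq E(H-v)\cup \mathrm{loops}_H(v)$; (QG4) for each circuit $C$ of $N$, the subgraph $H[C]$ has at most two components. A matroid is quasi-graphic if it has a framework. -}

module Defs where

open import Data.Nat using (ℕ; _≤_; _+_; _∸_; _⊓_; _<_)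
open import Data.Bool using (Bool; true; false; _∧_; not; _∨_)
open import Data.Fin using (Fin; _≟_)
open import Data.Fin.Subset
  using (Subset; _∈_; _∉_; _⊆_; _⊂_; _∪_; _∩_; _─_; ∁; ⁅_⁆; ∣_∣; Nonempty; ⊤; ⊥)
open import Data.Vec using (tabulate; lookup)
open import Data.Product using (Σ; ∃; _×_; _,_; proj₁; proj₂)
open import Data.Sum using (_⊎_)
open import Relation.Nullary using (¬_; ⌊_⌋)
open import Relation.Binary.PropositionalEquality using (_≡_)

-- Matroids on a ground set E ⊆ Fin n, given by a rank function.
-- The rank function is only meaningful on subsets of the ground set.

record RankData (n : ℕ) : Set where
  field
    ground : Subset n
    rank   : Subset n → ℕ
open RankData public

record IsMatroid {n : ℕ} (M : RankData n) : Set where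
  field
    R1 : ∀ X → X ⊆ ground M → rank M X ≤ ∣ X ∣
    R2 : ∀ X Y → X ⊆ Y → Y ⊆ ground M → rank M X ≤ rank M Y
    R3 : ∀ X Y → X ⊆ ground M → Y ⊆ ground M →
         rank M (X ∪ Y) + rank M (X ∩ Y) ≤ rank M X + rank M Y

module _ {n : ℕ} (M : RankData n) where

  Independent : Subset n → Set
  Independent X = X ⊆ ground M × rank M X ≡ ∣ X ∣

  Dependent : Subset n → Set
  Dependent X = X ⊆ ground M × ¬ (rank M X ≡ ∣ X ∣)

  IsCircuit : Subset n → Set
  IsCircuit C = Dependent C × (∀ D → D ⊂ C → Independent D)

  InClosure : Subset n → Fin n → Set
  InClosure X e = e ∈ ground M × rank M (X ∪ ⁅ e ⁆) ≡ rank M X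

-- Minors.  N = M / Y \ X  for disjoint X, Y ⊆ E(M) (same labelling of
-- elements by Fin n); proper means X ∪ Y ≠ ∅.

IsProperMinorOf : {n : ℕ} → RankData n → RankData n → Set
IsProperMinorOf {n} N M =
  Σ (Subset n) λ X → Σ (Subset n) λ Y →
    X ⊆ ground M × Y ⊆ ground M × X ∩ Y ≡ ⊥ × Nonempty (X ∪ Y) ×
    ground N ≡ ground M ─ (X ∪ Y) ×
    (∀ Z → Z ⊆ ground N → rank N Z ≡ rank M (Z ∪ Y) ∸ rank M Y)

U47 : RankData 7
U47 = record { ground = ⊤ ; rank = λ X → 4 ⊓ ∣ X ∣ }

-- Graphs with edge set E ⊆ Fin n and vertex set Fin m.  Loops and
-- parallel edges allowed.  `ends e` gives the two ends of edge e
-- (only meaningful for e ∈ E).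

module Graph {n m : ℕ} (E : Subset n) (ends : Fin n → Fin m × Fin m) where

  end₁ end₂ : Fin n → Fin m
  end₁ e = proj₁ (ends e)
  end₂ e = proj₂ (ends e)

  Incident : Fin n → Fin m → Set
  Incident e v = end₁ e ≡ v ⊎ end₂ e ≡ v

  incidentᵇ : Fin n → Fin m → Bool
  incidentᵇ e v = ⌊ end₁ e ≟ v ⌋ ∨ ⌊ end₂ e ≟ v ⌋

  IsLoopAt : Fin n → Fin m → Set
  IsLoopAt e v = end₁ e ≡ v × end₂ e ≡ v

  data Reach (S : Subset n) (u : Fin m) : Fin m → Set where
    here : Reach S u u
    step : ∀ {v w} e → Reach S u v → e ∈ S →
           (ends e ≡ (v , w) ⊎ ends e ≡ (w , v)) → Reach S u w

  IsComponent : Subset m → Set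
  IsComponent V' = Nonempty V' × (∀ u → u ∈ V' → ∀ w → (w ∈ V' → Reach E u w) × (Reach E u w → w ∈ V'))

  edgesOn : Subset m → Subset n
  edgesOn V' = tabulate λ e → lookup E e ∧ lookup V' (end₁ e) ∧ lookup V' (end₂ e)

  edgesAvoiding : Fin m → Subset n
  edgesAvoiding v = tabulate λ e → lookup E e ∧ not (incidentᵇ e v)

  AtMostTwoComponents : Subset n → Set
  AtMostTwoComponents C =
    ∃ λ (a : Fin m) → ∃ λ (b : Fin m) →
      ∀ e → e ∈ C → ∀ w → Incident e w → Reach C a w ⊎ Reach C b w

-- H (vertex set Fin m, incidence `ends`, edge set E(N)) is a framework for N.
-- (QG1) holds by construction: the edge set of H is ground N.
record Framework {n : ℕ} (N : RankData n) (m : ℕ) : Set where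
  field
    ends : Fin n → Fin m × Fin m
  open Graph (ground N) ends
  field
    QG2 : ∀ V' → IsComponent V' → rank N (edgesOn V') ≤ ∣ V' ∣
    QG3 : ∀ v e → InClosure N (edgesAvoiding v) e →
          e ∈ edgesAvoiding v ⊎ (e ∈ ground N × IsLoopAt e v)
    QG4 : ∀ C → IsCircuit N C → AtMostTwoComponents C

QuasiGraphic : {n : ℕ} → RankData n → Set
QuasiGraphic N = ∃ λ m → Framework N m

-- Suppose H were a framework for U₄,₇. A vertex v meeting a non-loop edge e meets at least four
-- edges: otherwise at least four edges avoid v, and these span e, against (QG3). Two such vertices
-- are adjacent, since disjoint stars would need eight of the seven edges; so they form a component
-- carrying at least four edges, of rank 4, which by (QG2) has at least four vertices. But four
-- vertices meeting four edges each need 16 incidences, while seven edges provide 14. Hence all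
-- edges are loops; by (QG2) no two share a vertex, and a five-element circuit then spans five
-- components, against (QG4).
--
-- Conversely, a proper minor of U₄,₇ is a uniform matroid U_{r,k} with r ≤ 4 and k ≤ 6. It is framed
-- on four vertices by loops at one vertex (r ≤ 1), parallel edges (r = 2), a doubled triangle
-- (r = 3) or a subgraph of K₄ (r = 4); (QG2)-(QG4) pass from the full graphs, where they are checked
-- by evaluation, to their subgraphs.
module Submission where

open import Defs
open import Data.Bool using (Bool; true; false; _∧_; not; T)
open import Data.Bool.Properties using (T-≡; T-∧; T-∨)
open import Data.Empty using (⊥)
open import Data.Unit using (tt)
open import Data.Fin using (Fin; zero; suc; punchOut; _≟_)
open import Data.Fin.Properties using (all?; any?; ¬∀⟶∃¬)
open import Data.Fin.Subset
  using (Subset; _∈_; _∉_; _⊆_; _⊂_; _∪_; _∩_; _─_; _-_; ∁; ⁅_⁆; ∣_∣; Nonempty; Empty; ⊤)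
open import Data.Fin.Subset.Properties
  using ( _∈?_; nonempty?; anySubset?; Empty-unique; ∣⊥∣≡0; ∣p∣≤n; ∣⁅x⁆∣≡1; ∣p∣≤∣p∪q∣
        ; p⊆q⇒∣p∣≤∣q∣; p⊂q⇒∣p∣<∣q∣; x∈p⇒∣p-x∣<∣p∣; x∈p⇒p-x⊂p; ∣∁p∣≡n∸∣p∣
        ; x∈⁅x⁆; x∈⁅y⁆⇒x≡y; x∉⁅y⁆⇒x≢y; x∈p∪q⁺; x∈p∪q⁻; x∈p∩q⁻; p⊆p∪q
        ; x∈p∧x≢y⇒x∈p-y; p─q⊆p; x∈∁p⇒x∉p; x∉p⇒x∈∁p; ∈⊤; ⊆⊤ )
open import Data.Nat using (ℕ; zero; suc; _+_; _∸_; _⊓_; _≤_; _<_; z≤n; s≤s; s≤s⁻¹; _≤?_; _<?_)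
  renaming (_≟_ to _≟ℕ_)
open import Data.Nat.Properties
  using ( +-suc; +-comm; +-identityʳ; +-mono-≤; ≤-reflexive; ≤-trans; ≤-antisym; ≤-<-trans; ≰⇒>; <⇒≱
        ; >⇒≢; 1+n≰n; m≤n⇒m≤1+n; m+n≤o⇒m≤o; ∸-monoʳ-≤; m∸n≤m; m≤n⇒m⊓n≡m; m≥n⇒m⊓n≡n; m⊓n≤m
        ; m⊓n≤n; ⊓-glb; ⊓-monoʳ-≤; allUpTo?; module ≤-Reasoning )
open import Data.Nat.Tactic.RingSolver using (solve-∀)
open import Data.Product using (Σ; ∃; ∃₂; _×_; _,_; proj₁; proj₂; uncurry)
open import Data.Sum using (_⊎_; inj₁; inj₂; [_,_]′)
import Data.Sum as Sum
open import Data.Vec using ([]; _∷_; tabulate; lookup; here; there)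
open import Data.Vec.Properties using (lookup∘tabulate; []=⇒lookup; lookup⇒[]=)
open import Function using (_∘_; case_of_)
open import Function.Bundles using (Equivalence)
open import Function.Definitions using (Injective)
open import Relation.Nullary using (¬_; Dec; yes; no; contradiction; ¬?)
open import Relation.Nullary.Decidable
  using (⌊_⌋; _×-dec_; _⊎-dec_; _→-dec_; map′; decidable-stable; toWitness; fromWitness)
open import Relation.Binary.PropositionalEquality
open import Relation.Unary using (Pred; Decidable)

pattern 0F = zero
pattern 1F = suc 0F
pattern 2F = suc 1F
pattern 3F = suc 2F

T-not⇒¬T : ∀ {b} → T (not b) → ¬ T b
T-not⇒¬T {false} _ ()

¬T⇒T-not : ∀ {b} → ¬ T b → T (not b)
¬T⇒T-not {true}  ¬t = ¬t tt
¬T⇒T-not {false} _  = tt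

T-lookup⇒∈ : ∀ {n} {p : Subset n} {i} → T (lookup p i) → i ∈ p
T-lookup⇒∈ {p = p} {i} t = lookup⇒[]= i p (Equivalence.to T-≡ t)

∈⇒T-lookup : ∀ {n} {p : Subset n} {i} → i ∈ p → T (lookup p i)
∈⇒T-lookup i∈p = Equivalence.from T-≡ ([]=⇒lookup i∈p)

∈tabulate⁺ : ∀ {n} {f : Fin n → Bool} {i} → T (f i) → i ∈ tabulate f
∈tabulate⁺ {f = f} {i} t = T-lookup⇒∈ (subst T (sym (lookup∘tabulate f i)) t)

∈tabulate⁻ : ∀ {n} {f : Fin n → Bool} {i} → i ∈ tabulate f → T (f i)
∈tabulate⁻ {f = f} {i} i∈ = subst T (lookup∘tabulate f i) (∈⇒T-lookup i∈)

restrict-⊆ : ∀ {n} {p : Subset n} {f : Fin n → Bool} → tabulate (λ i → lookup p i ∧ f i) ⊆ p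
restrict-⊆ i∈ = T-lookup⇒∈ (proj₁ (Equivalence.to T-∧ (∈tabulate⁻ i∈)))

restrict-mono : ∀ {n} {p q : Subset n} {f : Fin n → Bool} → p ⊆ q →
                tabulate (λ i → lookup p i ∧ f i) ⊆ tabulate (λ i → lookup q i ∧ f i)
restrict-mono p⊆q i∈ with Equivalence.to T-∧ (∈tabulate⁻ i∈)
... | i∈p , fi = ∈tabulate⁺ (Equivalence.from T-∧ (∈⇒T-lookup (p⊆q (T-lookup⇒∈ i∈p)) , fi))

x∈p─q⇒x∉q : ∀ {n} {x} (p q : Subset n) → x ∈ p ─ q → x ∉ q
x∈p─q⇒x∉q (_ ∷ p) (_ ∷ q) (there x∈) (there x∈q) = x∈p─q⇒x∉q p q x∈ x∈q
x∈p─q⇒x∉q (_ ∷ p) (true ∷ q) () here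

x∈p-y⇒x≢y : ∀ {n} {x y} (p : Subset n) → x ∈ p - y → x ≢ y
x∈p-y⇒x≢y {y = y} p x∈ = x∉⁅y⁆⇒x≢y (x∈p─q⇒x∉q p ⁅ y ⁆ x∈)

∣p∪q∣+∣p∩q∣≡∣p∣+∣q∣ : ∀ {n} (p q : Subset n) → ∣ p ∪ q ∣ + ∣ p ∩ q ∣ ≡ ∣ p ∣ + ∣ q ∣
∣p∪q∣+∣p∩q∣≡∣p∣+∣q∣ []         []         = refl
∣p∪q∣+∣p∩q∣≡∣p∣+∣q∣ (true ∷ p) (true ∷ q) =
  cong suc (trans (+-suc ∣ p ∪ q ∣ ∣ p ∩ q ∣)
                  (trans (cong suc (∣p∪q∣+∣p∩q∣≡∣p∣+∣q∣ p q)) (sym (+-suc ∣ p ∣ ∣ q ∣))))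
∣p∪q∣+∣p∩q∣≡∣p∣+∣q∣ (true ∷ p) (false ∷ q) = cong suc (∣p∪q∣+∣p∩q∣≡∣p∣+∣q∣ p q)
∣p∪q∣+∣p∩q∣≡∣p∣+∣q∣ (false ∷ p) (true ∷ q) =
  trans (cong suc (∣p∪q∣+∣p∩q∣≡∣p∣+∣q∣ p q)) (sym (+-suc ∣ p ∣ ∣ q ∣))
∣p∪q∣+∣p∩q∣≡∣p∣+∣q∣ (false ∷ p) (false ∷ q) = ∣p∪q∣+∣p∩q∣≡∣p∣+∣q∣ p q

∣p∪q∣≤∣p∣+∣q∣ : ∀ {n} (p q : Subset n) → ∣ p ∪ q ∣ ≤ ∣ p ∣ + ∣ q ∣
∣p∪q∣≤∣p∣+∣q∣ p q = m+n≤o⇒m≤o ∣ p ∪ q ∣ (≤-reflexive (∣p∪q∣+∣p∩q∣≡∣p∣+∣q∣ p q))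

Empty[p∩q]⇒∣p∪q∣≡∣p∣+∣q∣ : ∀ {n} (p q : Subset n) → Empty (p ∩ q) → ∣ p ∪ q ∣ ≡ ∣ p ∣ + ∣ q ∣
Empty[p∩q]⇒∣p∪q∣≡∣p∣+∣q∣ {n} p q disjoint = begin
  ∣ p ∪ q ∣              ≡⟨ +-identityʳ _ ⟨
  ∣ p ∪ q ∣ + 0          ≡⟨ cong (∣ p ∪ q ∣ +_) (trans (cong ∣_∣ (Empty-unique disjoint)) (∣⊥∣≡0 n)) ⟨
  ∣ p ∪ q ∣ + ∣ p ∩ q ∣  ≡⟨ ∣p∪q∣+∣p∩q∣≡∣p∣+∣q∣ p q ⟩
  ∣ p ∣ + ∣ q ∣          ∎
  where open ≡-Reasoning

Empty[p∩q]⇒∣p∣+∣q∣≤n : ∀ {n} (p q : Subset n) → Empty (p ∩ q) → ∣ p ∣ + ∣ q ∣ ≤ n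
Empty[p∩q]⇒∣p∣+∣q∣≤n p q disjoint =
  subst (_≤ _) (Empty[p∩q]⇒∣p∪q∣≡∣p∣+∣q∣ p q disjoint) (∣p∣≤n (p ∪ q))

-- The hypotheses say that no element lies in three of the four sets.
∣p∣+∣q∣+∣r∣+∣s∣≤2n : ∀ {n} (p q r s : Subset n) →
  Empty ((p ∩ q) ∩ (r ∪ s)) → Empty ((r ∩ s) ∩ (p ∪ q)) →
  (∣ p ∣ + ∣ q ∣) + (∣ r ∣ + ∣ s ∣) ≤ n + n
∣p∣+∣q∣+∣r∣+∣s∣≤2n {n} p q r s pq∩[r∪s]=∅ rs∩[p∪q]=∅ = begin
  (∣ p ∣ + ∣ q ∣) + (∣ r ∣ + ∣ s ∣)
    ≡⟨ cong₂ _+_ (∣p∪q∣+∣p∩q∣≡∣p∣+∣q∣ p q) (∣p∪q∣+∣p∩q∣≡∣p∣+∣q∣ r s) ⟨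
  (∣ p ∪ q ∣ + ∣ p ∩ q ∣) + (∣ r ∪ s ∣ + ∣ r ∩ s ∣)
    ≡⟨ rotate (∣ p ∪ q ∣) (∣ p ∩ q ∣) (∣ r ∪ s ∣) (∣ r ∩ s ∣) ⟩
  (∣ p ∩ q ∣ + ∣ r ∪ s ∣) + (∣ r ∩ s ∣ + ∣ p ∪ q ∣)
    ≤⟨ +-mono-≤ (Empty[p∩q]⇒∣p∣+∣q∣≤n _ _ pq∩[r∪s]=∅) (Empty[p∩q]⇒∣p∣+∣q∣≤n _ _ rs∩[p∪q]=∅) ⟩
  n + n ∎
  where
  open ≤-Reasoning
  rotate : ∀ a b c d → (a + b) + (c + d) ≡ (b + c) + (d + a)
  rotate = solve-∀

0<∣p∣⇒Nonempty : ∀ {n} {p : Subset n} → 0 < ∣ p ∣ → Nonempty p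
0<∣p∣⇒Nonempty {n} {p} 0<∣p∣ with nonempty? p
... | yes ne = ne
... | no ¬ne = contradiction (trans (cong ∣_∣ (Empty-unique ¬ne)) (∣⊥∣≡0 n)) (>⇒≢ 0<∣p∣)

x∈p⇒0<∣p∣ : ∀ {n} {p : Subset n} {x} → x ∈ p → 0 < ∣ p ∣
x∈p⇒0<∣p∣ x∈p = ≤-trans (s≤s z≤n) (x∈p⇒∣p-x∣<∣p∣ x∈p)

∣p∣≤1+∣p-x∣ : ∀ {n} (p : Subset n) x → ∣ p ∣ ≤ suc ∣ p - x ∣
∣p∣≤1+∣p-x∣ p x = begin
  ∣ p ∣                   ≤⟨ p⊆q⇒∣p∣≤∣q∣ p⊆[p-x]∪⁅x⁆ ⟩
  ∣ (p - x) ∪ ⁅ x ⁆ ∣     ≤⟨ ∣p∪q∣≤∣p∣+∣q∣ (p - x) ⁅ x ⁆ ⟩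
  ∣ p - x ∣ + ∣ ⁅ x ⁆ ∣   ≡⟨ cong (∣ p - x ∣ +_) (∣⁅x⁆∣≡1 x) ⟩
  ∣ p - x ∣ + 1           ≡⟨ +-comm ∣ p - x ∣ 1 ⟩
  suc ∣ p - x ∣           ∎
  where
  open ≤-Reasoning
  p⊆[p-x]∪⁅x⁆ : p ⊆ (p - x) ∪ ⁅ x ⁆
  p⊆[p-x]∪⁅x⁆ {y} y∈p with y ≟ x
  ... | yes refl = x∈p∪q⁺ (inj₂ (x∈⁅x⁆ y))
  ... | no y≢x   = x∈p∪q⁺ (inj₁ (x∈p∧x≢y⇒x∈p-y y∈p y≢x))

distinct∈⇒2≤∣p∣ : ∀ {n} {p : Subset n} {x y} → x ∈ p → y ∈ p → x ≢ y → 2 ≤ ∣ p ∣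
distinct∈⇒2≤∣p∣ x∈p y∈p x≢y =
  ≤-trans (s≤s (x∈p⇒0<∣p∣ (x∈p∧x≢y⇒x∈p-y y∈p (x≢y ∘ sym)))) (x∈p⇒∣p-x∣<∣p∣ x∈p)

embed-Fin : ∀ {n} k (p : Subset n) → k ≤ ∣ p ∣ →
            Σ (Fin k → Fin n) λ f → Injective _≡_ _≡_ f × (∀ i → f i ∈ p)
embed-Fin zero    p _       = (λ ()) , (λ { {()} }) , λ ()
embed-Fin (suc k) p k<∣p∣ with 0<∣p∣⇒Nonempty (≤-trans (s≤s z≤n) k<∣p∣)
... | x , x∈p with embed-Fin k (p - x) (s≤s⁻¹ (≤-trans k<∣p∣ (∣p∣≤1+∣p-x∣ p x)))
... | g , g-injective , g∈p-x = f , f-injective , f∈p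
  where
  f : Fin (suc k) → Fin _
  f zero    = x
  f (suc i) = g i
  f-injective : Injective _≡_ _≡_ f
  f-injective {zero}  {zero}  _      = refl
  f-injective {zero}  {suc j} x≡gj   = contradiction (sym x≡gj) (x∈p-y⇒x≢y p (g∈p-x j))
  f-injective {suc i} {zero}  gi≡x   = contradiction gi≡x (x∈p-y⇒x≢y p (g∈p-x i))
  f-injective {suc i} {suc j} gi≡gj  = cong suc (g-injective gi≡gj)
  f∈p : ∀ i → f i ∈ p
  f∈p zero    = x∈p
  f∈p (suc i) = p─q⊆p p ⁅ x ⁆ (g∈p-x i)

allSubset? : ∀ {n ℓ} {P : Pred (Subset n) ℓ} → Decidable P → Dec (∀ p → P p)
allSubset? P? = map′ (λ ¬∃¬P p → decidable-stable (P? p) (λ ¬Pp → ¬∃¬P (p , ¬Pp)))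
                     (λ ∀P (p , ¬Pp) → ¬Pp (∀P p))
                     (¬? (anySubset? (¬? ∘ P?)))

pigeonhole₃ : ∀ {A : Set} {a b x y z : A} →
  x ≡ a ⊎ x ≡ b → y ≡ a ⊎ y ≡ b → z ≡ a ⊎ z ≡ b → x ≡ y ⊎ x ≡ z ⊎ y ≡ z
pigeonhole₃ (inj₁ x≡a) (inj₁ y≡a) _          = inj₁ (trans x≡a (sym y≡a))
pigeonhole₃ (inj₂ x≡b) (inj₂ y≡b) _          = inj₁ (trans x≡b (sym y≡b))
pigeonhole₃ (inj₁ x≡a) (inj₂ _)   (inj₁ z≡a) = inj₂ (inj₁ (trans x≡a (sym z≡a)))
pigeonhole₃ (inj₂ _)   (inj₁ y≡a) (inj₁ z≡a) = inj₂ (inj₂ (trans y≡a (sym z≡a)))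
pigeonhole₃ (inj₁ _)   (inj₂ y≡b) (inj₂ z≡b) = inj₂ (inj₂ (trans y≡b (sym z≡b)))
pigeonhole₃ (inj₂ x≡b) (inj₁ _)   (inj₂ z≡b) = inj₂ (inj₁ (trans x≡b (sym z≡b)))

module GraphProperties {n m : ℕ} (E : Subset n) (ends : Fin n → Fin m × Fin m) where
  open Graph E ends public

  incident? : ∀ e v → Dec (Incident e v)
  incident? e v = (end₁ e ≟ v) ⊎-dec (end₂ e ≟ v)

  isLoopAt? : ∀ e v → Dec (IsLoopAt e v)
  isLoopAt? e v = (end₁ e ≟ v) ×-dec (end₂ e ≟ v)

  T-incidentᵇ⇒Incident : ∀ {e v} → T (incidentᵇ e v) → Incident e v
  T-incidentᵇ⇒Incident {e} {v} t =
    Sum.map (toWitness {a? = end₁ e ≟ v}) (toWitness {a? = end₂ e ≟ v}) (Equivalence.to T-∨ t)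

  Incident⇒T-incidentᵇ : ∀ {e v} → Incident e v → T (incidentᵇ e v)
  Incident⇒T-incidentᵇ {e} {v} e~v =
    Equivalence.from T-∨ (Sum.map (fromWitness {a? = end₁ e ≟ v}) (fromWitness {a? = end₂ e ≟ v}) e~v)

  ∈edgesAvoiding⇒¬Incident : ∀ {e v} → e ∈ edgesAvoiding v → ¬ Incident e v
  ∈edgesAvoiding⇒¬Incident e∈ =
    T-not⇒¬T (proj₂ (Equivalence.to T-∧ (∈tabulate⁻ e∈))) ∘ Incident⇒T-incidentᵇ

  ∉edgesAvoiding⇒Incident : ∀ {e v} → e ∈ E → e ∉ edgesAvoiding v → Incident e v
  ∉edgesAvoiding⇒Incident {e} {v} e∈E e∉ = decidable-stable (incident? e v) λ ¬e~v →
    e∉ (∈tabulate⁺ (Equivalence.from T-∧ (∈⇒T-lookup e∈E , ¬T⇒T-not (¬e~v ∘ T-incidentᵇ⇒Incident))))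

  ∈edgesOn⁺ : ∀ {e V'} → e ∈ E → end₁ e ∈ V' → end₂ e ∈ V' → e ∈ edgesOn V'
  ∈edgesOn⁺ e∈E e₁∈ e₂∈ =
    ∈tabulate⁺ (Equivalence.from T-∧ (∈⇒T-lookup e∈E , Equivalence.from T-∧ (∈⇒T-lookup e₁∈ , ∈⇒T-lookup e₂∈)))

  Incident-atMostTwo : ∀ {e u v w} → u ≢ v → u ≢ w → v ≢ w →
                       Incident e u → Incident e v → Incident e w → ⊥
  Incident-atMostTwo u≢v _   _   (inj₁ refl) (inj₁ refl) _           = u≢v refl
  Incident-atMostTwo u≢v _   _   (inj₂ refl) (inj₂ refl) _           = u≢v refl
  Incident-atMostTwo _   u≢w _   (inj₁ refl) (inj₂ _)    (inj₁ refl) = u≢w refl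
  Incident-atMostTwo _   _   v≢w (inj₁ _)    (inj₂ refl) (inj₂ refl) = v≢w refl
  Incident-atMostTwo _   _   v≢w (inj₂ _)    (inj₁ refl) (inj₁ refl) = v≢w refl
  Incident-atMostTwo _   u≢w _   (inj₂ refl) (inj₁ _)    (inj₂ refl) = u≢w refl

  Incident⇒joins : ∀ {e u w} → u ≢ w → Incident e u → Incident e w →
                   ends e ≡ (u , w) ⊎ ends e ≡ (w , u)
  Incident⇒joins u≢w (inj₁ refl) (inj₁ refl) = contradiction refl u≢w
  Incident⇒joins u≢w (inj₁ refl) (inj₂ refl) = inj₁ refl
  Incident⇒joins u≢w (inj₂ refl) (inj₁ refl) = inj₂ refl
  Incident⇒joins u≢w (inj₂ refl) (inj₂ refl) = contradiction refl u≢w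

  Incident⇒Reach : ∀ {S e u w} → e ∈ S → Incident e u → Incident e w → Reach S u w
  Incident⇒Reach {u = u} {w} e∈S e~u e~w with u ≟ w
  ... | yes refl = here
  ... | no u≢w   = step _ here e∈S (Incident⇒joins u≢w e~u e~w)

  covered⇒AtMostTwoComponents : ∀ {C} a b → (∀ e → e ∈ C → Incident e a ⊎ Incident e b) →
                                AtMostTwoComponents C
  covered⇒AtMostTwoComponents a b cover = a , b , λ e e∈C w e~w →
    Sum.map (λ e~a → Incident⇒Reach e∈C e~a e~w) (λ e~b → Incident⇒Reach e∈C e~b e~w) (cover e e∈C)

  edgesOn⊆E : ∀ V' → edgesOn V' ⊆ E
  edgesOn⊆E V' = restrict-⊆ {p = E} {f = λ e → lookup V' (end₁ e) ∧ lookup V' (end₂ e)}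

  edgesAvoiding⊆E : ∀ v → edgesAvoiding v ⊆ E
  edgesAvoiding⊆E v = restrict-⊆ {p = E} {f = λ e → not (incidentᵇ e v)}

module _ {n m : ℕ} {E E' : Subset n} (ends : Fin n → Fin m × Fin m) (E⊆E' : E ⊆ E') where
  open Graph

  edgesOn-mono : ∀ V' → edgesOn E ends V' ⊆ edgesOn E' ends V'
  edgesOn-mono V' = restrict-mono {f = λ e → lookup V' (proj₁ (ends e)) ∧ lookup V' (proj₂ (ends e))} E⊆E'

  edgesAvoiding-mono : ∀ v → edgesAvoiding E ends v ⊆ edgesAvoiding E' ends v
  edgesAvoiding-mono v = restrict-mono {f = λ e → not (incidentᵇ E ends e v)} E⊆E'

-- U₄,₇ is not quasi-graphic

first5 : Subset 7
first5 = true ∷ true ∷ true ∷ true ∷ true ∷ false ∷ false ∷ []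

first5-isCircuit : IsCircuit U47 first5
first5-isCircuit = (⊆⊤ , λ ()) , λ D D⊂first5 → ⊆⊤ , m≥n⇒m⊓n≡n (s≤s⁻¹ (p⊂q⇒∣p∣<∣q∣ D⊂first5))

module FrameworkForU47 {m : ℕ} (H : Framework U47 m) where
  open Framework H
  open GraphProperties ⊤ ends

  star : Fin m → Subset 7
  star v = ∁ (edgesAvoiding v)

  ∈star⇒Incident : ∀ {e v} → e ∈ star v → Incident e v
  ∈star⇒Incident {e} {v} e∈ = ∉edgesAvoiding⇒Incident {e} {v} ∈⊤ (x∈∁p⇒x∉p {p = edgesAvoiding v} e∈)

  -- Four edges avoiding v already have full rank 4, so by (QG3) they span no non-loop edge at v.
  nonloop⇒4≤∣star∣ : ∀ {e v} → Incident e v → ¬ IsLoopAt e v → 4 ≤ ∣ star v ∣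
  nonloop⇒4≤∣star∣ {e} {v} e~v ¬loop with 4 ≤? ∣ edgesAvoiding v ∣
  ... | yes 4≤∣A∣ =
    contradiction (QG3 v e (∈⊤ , spanned)) [ (λ e∈A → ∈edgesAvoiding⇒¬Incident e∈A e~v) , ¬loop ∘ proj₂ ]′
    where
    spanned : 4 ⊓ ∣ edgesAvoiding v ∪ ⁅ e ⁆ ∣ ≡ 4 ⊓ ∣ edgesAvoiding v ∣
    spanned = trans (m≤n⇒m⊓n≡m (≤-trans 4≤∣A∣ (∣p∣≤∣p∪q∣ (edgesAvoiding v) ⁅ e ⁆))) (sym (m≤n⇒m⊓n≡m 4≤∣A∣))
  ... | no 4≰∣A∣ = begin
    4                        ≤⟨ ∸-monoʳ-≤ 7 (s≤s⁻¹ (≰⇒> 4≰∣A∣)) ⟩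
    7 ∸ ∣ edgesAvoiding v ∣  ≡⟨ ∣∁p∣≡n∸∣p∣ (edgesAvoiding v) ⟨
    ∣ star v ∣               ∎
    where open ≤-Reasoning

  big : Subset m
  big = tabulate λ v → ⌊ 4 ≤? ∣ star v ∣ ⌋

  ∈big⁻ : ∀ {v} → v ∈ big → 4 ≤ ∣ star v ∣
  ∈big⁻ v∈ = toWitness (∈tabulate⁻ v∈)

  nonloop⇒∈big : ∀ {e v} → Incident e v → ¬ IsLoopAt e v → v ∈ big
  nonloop⇒∈big e~v ¬loop = ∈tabulate⁺ (fromWitness (nonloop⇒4≤∣star∣ e~v ¬loop))

  ends∈big : ∀ {e u} → u ∈ big → Incident e u → end₁ e ∈ big × end₂ e ∈ big
  ends∈big {e} u∈ e~u with end₁ e ≟ end₂ e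
  ... | no e₁≢e₂ = nonloop⇒∈big (inj₁ refl) (e₁≢e₂ ∘ sym ∘ proj₂) , nonloop⇒∈big (inj₂ refl) (e₁≢e₂ ∘ proj₁)
  ... | yes e₁≡e₂ with e~u
  ...   | inj₁ refl = u∈ , subst (_∈ big) e₁≡e₂ u∈
  ...   | inj₂ refl = subst (_∈ big) (sym e₁≡e₂) u∈ , u∈

  -- Two disjoint stars of size four would need eight of the seven edges.
  big-adjacent : ∀ {u w} → u ∈ big → w ∈ big → u ≢ w → ∃ λ f → ends f ≡ (u , w) ⊎ ends f ≡ (w , u)
  big-adjacent {u} {w} u∈ w∈ u≢w with any? (λ f → incident? f u ×-dec incident? f w)
  ... | yes (f , f~u , f~w) = f , Incident⇒joins u≢w f~u f~w
  ... | no ¬shared = contradiction (Empty[p∩q]⇒∣p∣+∣q∣≤n (star u) (star w) disjoint)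
                                   (<⇒≱ (+-mono-≤ (∈big⁻ u∈) (∈big⁻ w∈)))
    where
    disjoint : Empty (star u ∩ star w)
    disjoint (f , f∈) with x∈p∩q⁻ (star u) (star w) f∈
    ... | f∈u , f∈w = ¬shared (f , ∈star⇒Incident f∈u , ∈star⇒Incident f∈w)

  Reach-big : ∀ {u w} → Reach ⊤ u w → u ∈ big → w ∈ big
  Reach-big here                     u∈ = u∈
  Reach-big (step f r _ (inj₁ refl)) u∈ = proj₂ (ends∈big (Reach-big r u∈) (inj₁ refl))
  Reach-big (step f r _ (inj₂ refl)) u∈ = proj₁ (ends∈big (Reach-big r u∈) (inj₂ refl))

  big-isComponent : Nonempty big → IsComponent big
  big-isComponent ne = ne , λ u u∈ w → connect u∈ , λ r → Reach-big r u∈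
    where
    connect : ∀ {u w} → u ∈ big → w ∈ big → Reach ⊤ u w
    connect {u} {w} u∈ w∈ with u ≟ w
    ... | yes refl = here
    ... | no u≢w   = let f , f-joins = big-adjacent u∈ w∈ u≢w in step f here ∈⊤ f-joins

  4≤∣big∣ : Nonempty big → 4 ≤ ∣ big ∣
  4≤∣big∣ (u , u∈) = begin
    4                             ≡⟨ m≤n⇒m⊓n≡m 4≤∣edgesOn-big∣ ⟨
    4 ⊓ ∣ edgesOn big ∣           ≤⟨ QG2 big (big-isComponent (u , u∈)) ⟩
    ∣ big ∣                       ∎
    where
    open ≤-Reasoning
    star⊆edgesOn-big : star u ⊆ edgesOn big
    star⊆edgesOn-big e∈ = let e₁∈ , e₂∈ = ends∈big u∈ (∈star⇒Incident e∈) in ∈edgesOn⁺ ∈⊤ e₁∈ e₂∈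
    4≤∣edgesOn-big∣ : 4 ≤ ∣ edgesOn big ∣
    4≤∣edgesOn-big∣ = ≤-trans (∈big⁻ u∈) (p⊆q⇒∣p∣≤∣q∣ star⊆edgesOn-big)

  -- Four vertices with stars of size four need 16 incidences; seven edges provide at most 14.
  ¬four-big : (f : Fin 4 → Fin m) → Injective _≡_ _≡_ f → (∀ i → f i ∈ big) → ⊥
  ¬four-big f f-injective f∈big = <⇒≱ 16≤sum (m≤n⇒m≤1+n sum≤14)
    where
    S : Fin 4 → Subset 7
    S i = star (f i)
    16≤sum : 16 ≤ (∣ S 0F ∣ + ∣ S 1F ∣) + (∣ S 2F ∣ + ∣ S 3F ∣)
    16≤sum = +-mono-≤ (+-mono-≤ (∈big⁻ (f∈big 0F)) (∈big⁻ (f∈big 1F)))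
                      (+-mono-≤ (∈big⁻ (f∈big 2F)) (∈big⁻ (f∈big 3F)))
    f≢ : ∀ {i j} → i ≢ j → f i ≢ f j
    f≢ i≢j = i≢j ∘ f-injective
    thrice : ∀ {e} i j k → i ≢ j → i ≢ k → j ≢ k → e ∈ S i → e ∈ S j → e ∈ S k → ⊥
    thrice {e} i j k i≢j i≢k j≢k e∈i e∈j e∈k =
      Incident-atMostTwo {e} {f i} {f j} {f k} (f≢ i≢j) (f≢ i≢k) (f≢ j≢k)
        (∈star⇒Incident {e} {f i} e∈i) (∈star⇒Incident {e} {f j} e∈j) (∈star⇒Incident {e} {f k} e∈k)
    twice : ∀ i j k l → i ≢ j → i ≢ k → i ≢ l → j ≢ k → j ≢ l → Empty ((S i ∩ S j) ∩ (S k ∪ S l))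
    twice i j k l i≢j i≢k i≢l j≢k j≢l (e , e∈) =
      let e∈ij , e∈kl = x∈p∩q⁻ (S i ∩ S j) (S k ∪ S l) e∈
          e∈i , e∈j   = x∈p∩q⁻ (S i) (S j) e∈ij
      in [ thrice i j k i≢j i≢k j≢k e∈i e∈j , thrice i j l i≢j i≢l j≢l e∈i e∈j ]′ (x∈p∪q⁻ (S k) (S l) e∈kl)
    sum≤14 : (∣ S 0F ∣ + ∣ S 1F ∣) + (∣ S 2F ∣ + ∣ S 3F ∣) ≤ 14
    sum≤14 = ∣p∣+∣q∣+∣r∣+∣s∣≤2n (S 0F) (S 1F) (S 2F) (S 3F)
      (twice 0F 1F 2F 3F (λ ()) (λ ()) (λ ()) (λ ()) (λ ()))
      (twice 2F 3F 0F 1F (λ ()) (λ ()) (λ ()) (λ ()) (λ ()))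

  big-empty : Empty big
  big-empty ne = let f , f-injective , f∈big = embed-Fin 4 big (4≤∣big∣ ne) in ¬four-big f f-injective f∈big

  module AllLoops (loops : ∀ e → end₁ e ≡ end₂ e) where

    Reach⇒≡ : ∀ {S u w} → Reach S u w → w ≡ u
    Reach⇒≡ here                     = refl
    Reach⇒≡ (step f r _ (inj₁ refl)) = trans (sym (loops f)) (Reach⇒≡ r)
    Reach⇒≡ (step f r _ (inj₂ refl)) = trans (loops f) (Reach⇒≡ r)

    ⁅v⁆-isComponent : ∀ v → IsComponent ⁅ v ⁆
    ⁅v⁆-isComponent v = (v , x∈⁅x⁆ v) , λ u u∈ w →
      (λ w∈ → subst (Reach ⊤ u) (trans (x∈⁅y⁆⇒x≡y v u∈) (sym (x∈⁅y⁆⇒x≡y v w∈))) here) ,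
      (λ r → subst (_∈ ⁅ v ⁆) (sym (Reach⇒≡ r)) u∈)

    -- Two loops at v would give the one-vertex component {v} rank 2.
    distinct-loops : ∀ e f → e ≢ f → end₁ e ≢ end₁ f
    distinct-loops e f e≢f e₁≡f₁ = 1+n≰n (begin
      2                              ≤⟨ ⊓-glb (s≤s (s≤s z≤n)) (distinct∈⇒2≤∣p∣ (at-v e refl) (at-v f (sym e₁≡f₁)) e≢f) ⟩
      4 ⊓ ∣ edgesOn ⁅ end₁ e ⁆ ∣      ≤⟨ QG2 ⁅ end₁ e ⁆ (⁅v⁆-isComponent (end₁ e)) ⟩
      ∣ ⁅ end₁ e ⁆ ∣                  ≡⟨ ∣⁅x⁆∣≡1 (end₁ e) ⟩
      1                              ∎)
      where
      open ≤-Reasoning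
      at-v : ∀ g → end₁ g ≡ end₁ e → g ∈ edgesOn ⁅ end₁ e ⁆
      at-v g g₁≡e₁ = ∈edgesOn⁺ {g} {⁅ end₁ e ⁆} ∈⊤
        (subst (_∈ ⁅ end₁ e ⁆) (sym g₁≡e₁) (x∈⁅x⁆ (end₁ e)))
        (subst (_∈ ⁅ end₁ e ⁆) (trans (sym g₁≡e₁) (loops g)) (x∈⁅x⁆ (end₁ e)))

    -- The loops 0, 1, 2 of the circuit first5 would sit at the two vertices a and b.
    ¬AtMostTwoComponents-first5 : ¬ AtMostTwoComponents first5
    ¬AtMostTwoComponents-first5 (a , b , reach) =
      [ distinct-loops 0F 1F (λ ()) , [ distinct-loops 0F 2F (λ ()) , distinct-loops 1F 2F (λ ()) ]′ ]′
        (pigeonhole₃ (at-a-or-b 0F here) (at-a-or-b 1F (there here)) (at-a-or-b 2F (there (there here))))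
      where
      at-a-or-b : ∀ e → e ∈ first5 → end₁ e ≡ a ⊎ end₁ e ≡ b
      at-a-or-b e e∈ = Sum.map Reach⇒≡ Reach⇒≡ (reach e e∈ (end₁ e) (inj₁ refl))

    impossible : ⊥
    impossible = ¬AtMostTwoComponents-first5 (QG4 first5 first5-isCircuit)

  ¬nonloop : ∀ e → end₁ e ≢ end₂ e → ⊥
  ¬nonloop e e₁≢e₂ = big-empty (end₁ e , nonloop⇒∈big {e} {end₁ e} (inj₁ refl) (e₁≢e₂ ∘ sym ∘ proj₂))

  impossible : ⊥
  impossible = case all? (λ e → end₁ e ≟ end₂ e) of λ where
    (yes loops) → AllLoops.impossible loops
    (no ¬loops) → uncurry ¬nonloop (¬∀⟶∃¬ 7 _ (λ e → end₁ e ≟ end₂ e) ¬loops)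

U47-not-quasiGraphic : ¬ QuasiGraphic U47
U47-not-quasiGraphic (_ , H) = FrameworkForU47.impossible H

-- Proper minors of U₄,₇ are quasi-graphic

IsUniform : ∀ {n} → RankData n → ℕ → Set
IsUniform N r = ∀ Z → Z ⊆ ground N → rank N Z ≡ r ⊓ ∣ Z ∣

m⊓[o+n]∸m⊓n≡[m∸n]⊓o : ∀ m n o → m ⊓ (o + n) ∸ m ⊓ n ≡ (m ∸ n) ⊓ o
m⊓[o+n]∸m⊓n≡[m∸n]⊓o zero    zero    o = refl
m⊓[o+n]∸m⊓n≡[m∸n]⊓o zero    (suc n) o = refl
m⊓[o+n]∸m⊓n≡[m∸n]⊓o (suc m) zero    o = cong (suc m ⊓_) (+-identityʳ o)
m⊓[o+n]∸m⊓n≡[m∸n]⊓o (suc m) (suc n) o = trans (cong (λ k → suc m ⊓ k ∸ suc (m ⊓ n)) (+-suc o n))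
                                               (m⊓[o+n]∸m⊓n≡[m∸n]⊓o m n o)

properMinor-isUniform : ∀ {n} {M N : RankData n} {k} → IsUniform M k → IsProperMinorOf N M →
                        ∃ λ r → r ≤ k × IsUniform N r
properMinor-isUniform {M = M} {N} {k} M-uniform (X , Y , _ , Y⊆M , _ , _ , ground≡ , rank≡) =
  k ∸ ∣ Y ∣ , m∸n≤m k ∣ Y ∣ , λ Z Z⊆N → begin
    rank N Z                           ≡⟨ rank≡ Z Z⊆N ⟩
    rank M (Z ∪ Y) ∸ rank M Y          ≡⟨ cong₂ _∸_ (M-uniform (Z ∪ Y) (Z∪Y⊆M Z⊆N)) (M-uniform Y Y⊆M) ⟩
    k ⊓ ∣ Z ∪ Y ∣ ∸ k ⊓ ∣ Y ∣          ≡⟨ cong (λ s → k ⊓ s ∸ k ⊓ ∣ Y ∣) (Empty[p∩q]⇒∣p∪q∣≡∣p∣+∣q∣ Z Y (Z∩Y=∅ Z⊆N)) ⟩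
    k ⊓ (∣ Z ∣ + ∣ Y ∣) ∸ k ⊓ ∣ Y ∣    ≡⟨ m⊓[o+n]∸m⊓n≡[m∸n]⊓o k ∣ Y ∣ ∣ Z ∣ ⟩
    (k ∸ ∣ Y ∣) ⊓ ∣ Z ∣                ∎
  where
  open ≡-Reasoning
  ∈N⇒∉X∪Y : ∀ {x} → x ∈ ground N → x ∉ X ∪ Y
  ∈N⇒∉X∪Y x∈N = x∈p─q⇒x∉q (ground M) (X ∪ Y) (subst (_ ∈_) ground≡ x∈N)
  Z∪Y⊆M : ∀ {Z} → Z ⊆ ground N → Z ∪ Y ⊆ ground M
  Z∪Y⊆M Z⊆N x∈ with x∈p∪q⁻ _ Y x∈
  ... | inj₁ x∈Z = p─q⊆p (ground M) (X ∪ Y) (subst (_ ∈_) ground≡ (Z⊆N x∈Z))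
  ... | inj₂ x∈Y = Y⊆M x∈Y
  Z∩Y=∅ : ∀ {Z} → Z ⊆ ground N → Empty (Z ∩ Y)
  Z∩Y=∅ {Z} Z⊆N (x , x∈) with x∈p∩q⁻ Z Y x∈
  ... | x∈Z , x∈Y = ∈N⇒∉X∪Y (Z⊆N x∈Z) (x∈p∪q⁺ (inj₂ x∈Y))

properMinor⇒∃∉ground : ∀ {n} {M N : RankData n} → IsProperMinorOf N M → ∃ λ d → d ∉ ground N
properMinor⇒∃∉ground {M = M} (X , Y , _ , _ , _ , (d , d∈X∪Y) , ground≡ , _) =
  d , λ d∈N → x∈p─q⇒x∉q (ground M) (X ∪ Y) (subst (d ∈_) ground≡ d∈N) d∈X∪Y

uniform-circuit-size : ∀ {n} {N : RankData n} {r C} → IsUniform N r → IsCircuit N C → ∣ C ∣ ≡ suc r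
uniform-circuit-size {N = N} {r} {C} N-uniform ((C⊆N , dependent) , minimal) = ≤-antisym ∣C∣≤1+r r<∣C∣
  where
  r<∣C∣ : r < ∣ C ∣
  r<∣C∣ = ≰⇒> λ ∣C∣≤r → dependent (trans (N-uniform C C⊆N) (m≥n⇒m⊓n≡n ∣C∣≤r))
  ∣C∣≤1+r : ∣ C ∣ ≤ suc r
  ∣C∣≤1+r with 0<∣p∣⇒Nonempty (≤-<-trans z≤n r<∣C∣)
  ... | x , x∈C = begin
    ∣ C ∣              ≤⟨ ∣p∣≤1+∣p-x∣ C x ⟩
    suc ∣ C - x ∣      ≡⟨ cong suc (proj₂ (minimal (C - x) (x∈p⇒p-x⊂p x∈C))) ⟨
    suc (rank N (C - x)) ≡⟨ cong suc (N-uniform (C - x) (C⊆N ∘ p─q⊆p C ⁅ x ⁆)) ⟩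
    suc (r ⊓ ∣ C - x ∣) ≤⟨ s≤s (m⊓n≤m r _) ⟩
    suc r              ∎
    where open ≤-Reasoning

uniform-closure : ∀ {n} {N : RankData n} {r A e} → IsUniform N r → A ⊆ ground N → ∣ A ∣ < r →
                  InClosure N A e → e ∈ A
uniform-closure {N = N} {r} {A} {e} N-uniform A⊆N ∣A∣<r (e∈N , same-rank) with e ∈? A
... | yes e∈A = e∈A
... | no e∉A  = contradiction same-rank (>⇒≢ (begin-strict
  rank N A                  ≡⟨ N-uniform A A⊆N ⟩
  r ⊓ ∣ A ∣                 ≤⟨ m⊓n≤n r ∣ A ∣ ⟩
  ∣ A ∣                     <⟨ ⊓-glb ∣A∣<r (p⊂q⇒∣p∣<∣q∣ (p⊆p∪q ⁅ e ⁆ , e , x∈p∪q⁺ (inj₂ (x∈⁅x⁆ e)) , e∉A)) ⟩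
  r ⊓ ∣ A ∪ ⁅ e ⁆ ∣         ≡⟨ N-uniform (A ∪ ⁅ e ⁆) A∪e⊆N ⟨
  rank N (A ∪ ⁅ e ⁆)        ∎))
  where
  open ≤-Reasoning
  A∪e⊆N : A ∪ ⁅ e ⁆ ⊆ ground N
  A∪e⊆N x∈ with x∈p∪q⁻ A ⁅ e ⁆ x∈
  ... | inj₁ x∈A = A⊆N x∈A
  ... | inj₂ x≡e = subst (_∈ ground N) (sym (x∈⁅y⁆⇒x≡y e x≡e)) e∈N

uniformShape : ℕ → Fin 6 → Fin 4 × Fin 4
uniformShape 0 _  = 0F , 0F
uniformShape 1 _  = 0F , 0F
uniformShape 2 _  = 0F , 1F
uniformShape 3 0F = 0F , 1F
uniformShape 3 1F = 0F , 2F
uniformShape 3 2F = 1F , 2F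
uniformShape 3 3F = 0F , 1F
uniformShape 3 (suc 3F) = 0F , 2F
uniformShape 3 (suc (suc 3F)) = 1F , 2F
uniformShape (suc (suc (suc (suc _)))) 0F = 0F , 1F
uniformShape (suc (suc (suc (suc _)))) 1F = 0F , 2F
uniformShape (suc (suc (suc (suc _)))) 2F = 0F , 3F
uniformShape (suc (suc (suc (suc _)))) 3F = 1F , 2F
uniformShape (suc (suc (suc (suc _)))) (suc 3F) = 1F , 3F
uniformShape (suc (suc (suc (suc _)))) (suc (suc 3F)) = 2F , 3F

-- The elements other than d are numbered by punchOut; d itself gets an arbitrary loop.
uniformEnds : ℕ → Fin 7 → Fin 7 → Fin 4 × Fin 4
uniformEnds r d e with d ≟ e
... | yes _  = 0F , 0F
... | no d≢e = uniformShape r (punchOut d≢e)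

module UniformGraph (r : ℕ) (d : Fin 7) = GraphProperties (∁ ⁅ d ⁆) (uniformEnds r d)

-- The facts about the full graphs behind (QG2)-(QG4), for all r ≤ 4 and d, decided by evaluation.

UniformGraph-QG2 : ∀ {r} → r < 5 → ∀ d V' → r ⊓ ∣ UniformGraph.edgesOn r d V' ∣ ≤ ∣ V' ∣
UniformGraph-QG2 = toWitness {a? = allUpTo? (λ r → all? λ d → allSubset? λ V' →
  r ⊓ ∣ UniformGraph.edgesOn r d V' ∣ ≤? ∣ V' ∣) 5} _

UniformGraph-QG3 : ∀ {r} → r < 5 → ∀ d v e → e ≢ d → UniformGraph.Incident r d e v →
  ¬ UniformGraph.IsLoopAt r d e v → ∣ UniformGraph.edgesAvoiding r d v ∣ < r
UniformGraph-QG3 = toWitness {a? = allUpTo? (λ r → all? λ d → all? λ v → all? λ e →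
  ¬? (e ≟ d) →-dec UniformGraph.incident? r d e v →-dec ¬? (UniformGraph.isLoopAt? r d e v)
  →-dec ∣ UniformGraph.edgesAvoiding r d v ∣ <? r) 5} _

UniformGraph-QG4 : ∀ {r} → r < 5 → ∀ d C → d ∉ C → ∣ C ∣ ≡ suc r →
  ∃₂ λ a b → ∀ e → e ∈ C → UniformGraph.Incident r d e a ⊎ UniformGraph.Incident r d e b
UniformGraph-QG4 = toWitness {a? = allUpTo? (λ r → all? λ d → allSubset? λ C →
  ¬? (d ∈? C) →-dec (∣ C ∣ ≟ℕ suc r) →-dec any? λ a → any? λ b → all? λ e →
  e ∈? C →-dec (UniformGraph.incident? r d e a ⊎-dec UniformGraph.incident? r d e b)) 5} _

module _ {N : RankData 7} {r : ℕ} {d : Fin 7} (r≤4 : r ≤ 4) (d∉N : d ∉ ground N) (N-uniform : IsUniform N r) where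
  open GraphProperties (ground N) (uniformEnds r d)

  ground⊆∁⁅d⁆ : ground N ⊆ ∁ ⁅ d ⁆
  ground⊆∁⁅d⁆ {x} x∈N = x∉p⇒x∈∁p λ x∈⁅d⁆ → d∉N (subst (_∈ ground N) (x∈⁅y⁆⇒x≡y d x∈⁅d⁆) x∈N)

  uniform-QG2 : ∀ V' → rank N (edgesOn V') ≤ ∣ V' ∣
  uniform-QG2 V' = begin
    rank N (edgesOn V')                    ≡⟨ N-uniform (edgesOn V') (edgesOn⊆E V') ⟩
    r ⊓ ∣ edgesOn V' ∣                     ≤⟨ ⊓-monoʳ-≤ r (p⊆q⇒∣p∣≤∣q∣ (edgesOn-mono (uniformEnds r d) ground⊆∁⁅d⁆ V')) ⟩
    r ⊓ ∣ UniformGraph.edgesOn r d V' ∣    ≤⟨ UniformGraph-QG2 (s≤s r≤4) d V' ⟩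
    ∣ V' ∣                                 ∎
    where open ≤-Reasoning

  spanned-nonloop∈edgesAvoiding : ∀ {v e} → ¬ IsLoopAt e v → InClosure N (edgesAvoiding v) e → e ∈ edgesAvoiding v
  spanned-nonloop∈edgesAvoiding {v} {e} ¬loop e∈cl@(e∈N , _) =
    decidable-stable (e ∈? edgesAvoiding v) λ e∉A → e∉A (uniform-closure N-uniform (edgesAvoiding⊆E v) (∣A∣<r e∉A) e∈cl)
    where
    ∣A∣<r : e ∉ edgesAvoiding v → ∣ edgesAvoiding v ∣ < r
    ∣A∣<r e∉A = ≤-<-trans (p⊆q⇒∣p∣≤∣q∣ (edgesAvoiding-mono (uniformEnds r d) ground⊆∁⁅d⁆ v))
      (UniformGraph-QG3 (s≤s r≤4) d v e (λ e≡d → d∉N (subst (_∈ ground N) e≡d e∈N))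
                        (∉edgesAvoiding⇒Incident e∈N e∉A) ¬loop)

  uniform-QG3 : ∀ v e → InClosure N (edgesAvoiding v) e → e ∈ edgesAvoiding v ⊎ (e ∈ ground N × IsLoopAt e v)
  uniform-QG3 v e e∈cl = case isLoopAt? e v of λ where
    (yes loop) → inj₂ (proj₁ e∈cl , loop)
    (no ¬loop) → inj₁ (spanned-nonloop∈edgesAvoiding ¬loop e∈cl)

  uniform-QG4 : ∀ C → IsCircuit N C → AtMostTwoComponents C
  uniform-QG4 C C-circuit =
    let a , b , cover = UniformGraph-QG4 (s≤s r≤4) d C (d∉N ∘ proj₁ (proj₁ C-circuit))
                                         (uniform-circuit-size N-uniform C-circuit)
    in covered⇒AtMostTwoComponents a b cover

  uniform-framework : Framework N 4
  uniform-framework = record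
    { ends = uniformEnds r d
    ; QG2  = λ V' _ → uniform-QG2 V'
    ; QG3  = uniform-QG3
    ; QG4  = uniform-QG4
    }

properMinor-of-U47-quasiGraphic : ∀ N → IsMatroid N → IsProperMinorOf N U47 → QuasiGraphic N
properMinor-of-U47-quasiGraphic N _ N≼U47 =
  let r , r≤4 , N-uniform = properMinor-isUniform {M = U47} {k = 4} (λ _ _ → refl) N≼U47
      d , d∉N             = properMinor⇒∃∉ground {M = U47} N≼U47
  in 4 , uniform-framework r≤4 d∉N N-uniform

theorem3p2 : ¬ QuasiGraphic U47 × (∀ N → IsMatroid N → IsProperMinorOf N U47 → QuasiGraphic N)
theorem3p2 = U47-not-quasiGraphic , properMinor-of-U47-quasiGraphic
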